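{- For the Web graph $\mathbb{W}_{n}$ and every $n\ge 4$, $\operatorname{mdim}(\mathbb{W}_{n})=n+1$.
   Context: For an integer $n\ge 3$, the Web graph $\mathbb{W}_{n}$ has vertex set $\{p_i,q_i,r_i : 1\le i\le n\}$ and edge set $\{p_iq_i,\ p_ip_{i+1},\ q_iq_{i+1},\ q_ir_i : 1\le i\le n\}$, with indices taken modulo $n$. For a connected graph $H$, $d_H(u,v)$ is the shortest-path distance, and for a vertex $x$ and an edge $e=uv$, $d_H(x,e)=\min\{d_H(x,u),d_H(x,v)\}$. A set $M\subseteq V(H)$ is a mixed metric generator of $H$ if for every two distinct elements $y_1,y_2\in V(H)\cup E(H)$ there is a vertex $z\in M$ with $d_H(z,y_1)\ne d_H(z,y_2)$. The mixed metric dimension $\operatorname{mdim}(H)$ is the minimum cardinality of a mixed metric generator of $H$. -}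

module Defs where

open import Data.Nat using (ℕ; zero; suc; _+_; _≤_; _⊔_; _⊓_)
open import Data.Nat.DivMod using (_mod_)
open import Data.Bool using (Bool; true; false; _∧_; _∨_; if_then_else_; T)
open import Data.Fin using (Fin; toℕ)
import Data.Fin as F
open import Data.List using (List; []; _∷_; map; length; _++_; allFin)
open import Data.Bool.ListAction using (any)
open import Data.Nat.ListAction using (sum)
open import Data.Product using (Σ; _×_; _,_; ∃)
open import Data.Sum using (_⊎_)
open import Data.Empty using (⊥)
open import Relation.Nullary using (¬_)
open import Relation.Nullary.Decidable using (⌊_⌋)
open import Relation.Binary.PropositionalEquality using (_≡_; _≢_)

record FinGraph : Set₁ where
  field
    V     : Set
    verts : List V              -- enumeration of V(H), each vertex exactly once
    eqV   : V → V → Bool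
    adj   : V → V → Bool        -- adjacency (symmetric)

module _ (H : FinGraph) where
  open FinGraph H

  within : ℕ → V → V → Bool
  within zero    u v = eqV u v
  within (suc k) u v = within k u v ∨ any (λ w → adj u w ∧ within k w v) verts

  search : ℕ → ℕ → V → V → ℕ
  search zero       k u v = k
  search (suc fuel) k u v = if within k u v then k else search fuel (suc k) u v

  -- shortest-path distance d_H(u,v) (graphs here are connected; a path
  -- has length < |V(H)|, so the search with fuel |V(H)| suffices)
  dist : V → V → ℕ
  dist u v = search (length verts) 0 u v

  data Elem : Set where
    vtx : V → Elem
    edg : (u v : V) → T (adj u v) → Elem

  SameElem : Elem → Elem → Set
  SameElem (vtx a)       (vtx b)         = a ≡ b
  SameElem (vtx _)       (edg _ _ _)     = ⊥
  SameElem (edg _ _ _)   (vtx _)         = ⊥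
  SameElem (edg u v _)   (edg u' v' _)   = (u ≡ u' × v ≡ v') ⊎ (u ≡ v' × v ≡ u')

  distE : V → Elem → ℕ
  distE x (vtx a)     = dist x a
  distE x (edg u v _) = dist x u ⊓ dist x v

  card : (V → Bool) → ℕ
  card M = sum (map (λ v → if M v then 1 else 0) verts)

  IsMixedMetricGenerator : (V → Bool) → Set
  IsMixedMetricGenerator M =
    (y₁ y₂ : Elem) → ¬ SameElem y₁ y₂ →
    Σ V (λ z → T (M z) × distE z y₁ ≢ distE z y₂)

  MixedMetricDimensionIs : ℕ → Set
  MixedMetricDimensionIs k =
    (Σ (V → Bool) (λ M → IsMixedMetricGenerator M × card M ≡ k)) ×
    ((M : V → Bool) → IsMixedMetricGenerator M → k ≤ card M)

data Kind : Set where
  p q r : Kind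

eqKind : Kind → Kind → Bool
eqKind p p = true
eqKind q q = true
eqKind r r = true
eqKind _ _ = false

_==ᶠ_ : ∀ {n} → Fin n → Fin n → Bool
i ==ᶠ j = ⌊ i F.≟ j ⌋

next : ∀ {n} → Fin n → Fin n
next {suc m} i = suc (toℕ i) mod (suc m)

WebV : ℕ → Set
WebV n = Kind × Fin n

webVerts : (n : ℕ) → List (WebV n)
webVerts n = map (p ,_) (allFin n) ++ (map (q ,_) (allFin n) ++ map (r ,_) (allFin n))

webEq : ∀ {n} → WebV n → WebV n → Bool
webEq (k , i) (l , j) = eqKind k l ∧ (i ==ᶠ j)

webAdj : ∀ {n} → WebV n → WebV n → Bool
webAdj (p , i) (q , j) = i ==ᶠ j
webAdj (q , i) (p , j) = i ==ᶠ j
webAdj (p , i) (p , j) = (j ==ᶠ next i) ∨ (i ==ᶠ next j)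
webAdj (q , i) (q , j) = (j ==ᶠ next i) ∨ (i ==ᶠ next j)
webAdj (q , i) (r , j) = i ==ᶠ j
webAdj (r , i) (q , j) = i ==ᶠ j
webAdj _       _       = false

Web : ℕ → FinGraph
Web n = record { V = WebV n ; verts = webVerts n ; eqV = webEq ; adj = webAdj }

{-# OPTIONS --safe #-}
module Submission where

-- A generator is {p₀} ∪ {r_j}. Read off the distances to the pendant vertices r_j, every vertex
-- or edge y has a level ℓ (its distance to the nearest r_j) and the set of j attaining it: r_i
-- and q_ir_i have level 0 at {i}, q_i and p_iq_i level 1 at {i}, q_iq_{i+1} level 1 at
-- {i, i+1}, p_i level 2 at {i} and p_ip_{i+1} level 2 at {i, i+1}. The two remaining ties are
-- broken by r_{i+1}, which is closer to q_i than to r_i, and by p₀, which is closer to p_i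
-- than to q_i because collapsing every spoke p_kq_k onto p_k shortens walks leaving the rim.
-- Conversely a generator contains every r_j, the only vertex separating q_j from q_jr_j, and
-- some p_i or q_i, since no r_j separates q₀ from p₀q₀. The argument works for every n ≥ 3.

open import Defs
open import Data.Bool using (Bool; true; false; T; _∧_; _∨_; if_then_else_)
open import Data.Bool.Properties using (T-∨; T-∧; ∨-comm)
open import Data.Empty using (⊥; ⊥-elim)
open import Data.Fin using (Fin; toℕ; fromℕ<) renaming (zero to fz; suc to fs)
import Data.Fin as F
open import Data.Fin.Properties using (toℕ-injective; toℕ-fromℕ<; fromℕ<-toℕ; toℕ<n; toℕ≤pred[n])
open import Data.List using (List; []; _∷_; map; length; _++_; allFin)
open import Data.List.Properties using (map-++; length-++; length-map; length-tabulate)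
open import Data.List.Membership.Propositional using (_∈_; lose)
open import Data.List.Membership.Propositional.Properties using (∈-allFin; ∈-map⁺; ∈-++⁺ˡ; ∈-++⁺ʳ)
open import Data.List.Relation.Unary.All using (All; []; _∷_)
import Data.List.Relation.Unary.All.Properties as All
open import Data.List.Relation.Unary.Any using (here; there; any?; satisfied)
open import Data.List.Relation.Unary.Any.Properties using (any⁺; any⁻)
open import Data.Nat using (ℕ; zero; suc; _+_; _≤_; _<_; _⊓_; z≤n; s≤s)
open import Data.Nat.DivMod using (_%_; m<n⇒m%n≡m; n%n≡0)
open import Data.Nat.ListAction using (sum)
open import Data.Nat.ListAction.Properties using (sum-++)
open import Data.Nat.Properties
open import Data.Nat.Solver using (module +-*-Solver)
open import Data.Product using (Σ; _×_; _,_; proj₂)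
open import Data.Sum using (_⊎_; inj₁; inj₂; [_,_]′)
import Data.Sum as Sum
open import Function using (_∘_)
open import Function.Bundles using (Equivalence)
open import Relation.Nullary using (¬_; Dec; yes; no)
open import Relation.Nullary.Decidable using (T?; ¬?; _×-dec_; map′; decidable-stable; toWitness; fromWitness)
open import Relation.Binary.PropositionalEquality hiding ([_])

open Equivalence using (to; from)

module _ {A : Set} (M : A → Bool) where

  indicator : A → ℕ
  indicator x = if M x then 1 else 0

  count : List A → ℕ
  count xs = sum (map indicator xs)

  count-++ : ∀ xs ys → count (xs ++ ys) ≡ count xs + count ys
  count-++ xs ys = trans (cong sum (map-++ indicator xs ys)) (sum-++ (map indicator xs) (map indicator ys))

  count-all : ∀ {xs} → All (T ∘ M) xs → count xs ≡ length xs
  count-all []                 = refl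
  count-all (_∷_ {x} Mx Mxs) with M x
  ... | true = cong suc (count-all Mxs)

  count-none : ∀ {xs} → All (¬_ ∘ T ∘ M) xs → count xs ≡ 0
  count-none []                 = refl
  count-none (_∷_ {x} ¬Mx ¬Mxs) with M x
  ... | true  = ⊥-elim (¬Mx _)
  ... | false = count-none ¬Mxs

  count-∈ : ∀ {x xs} → x ∈ xs → T (M x) → 1 ≤ count xs
  count-∈ {xs = y ∷ ys} (here refl) Mx with M y
  ... | true = s≤s z≤n
  count-∈ {xs = y ∷ ys} (there x∈ys) Mx = ≤-trans (count-∈ x∈ys Mx) (m≤n+m _ _)

¬pair⊆single : ∀ {A : Set} {i k w : A} → w ≢ k → (∀ {j} → j ≡ k ⊎ j ≡ w → j ≡ i) → ⊥
¬pair⊆single w≢k ⊆i = w≢k (trans (⊆i (inj₂ refl)) (sym (⊆i (inj₁ refl))))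

pair⊆pair : ∀ {A : Set} {i w k w′ : A} → w ≢ i → (∀ {j} → j ≡ i ⊎ j ≡ w → j ≡ k ⊎ j ≡ w′) →
            (i ≡ k × w ≡ w′) ⊎ (i ≡ w′ × w ≡ k)
pair⊆pair w≢i ⊆ with ⊆ (inj₁ refl) | ⊆ (inj₂ refl)
... | inj₁ i≡k  | inj₁ w≡k  = ⊥-elim (w≢i (trans w≡k (sym i≡k)))
... | inj₁ i≡k  | inj₂ w≡w′ = inj₁ (i≡k , w≡w′)
... | inj₂ i≡w′ | inj₁ w≡k  = inj₂ (i≡w′ , w≡k)
... | inj₂ i≡w′ | inj₂ w≡w′ = ⊥-elim (w≢i (trans w≡w′ (sym i≡w′)))

record WellFormed (H : FinGraph) : Set where
  open FinGraph H
  field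
    eqV-sound : ∀ {u v} → T (eqV u v) → u ≡ v
    eqV-refl  : ∀ u → T (eqV u u)
    adj-sym   : ∀ {u v} → T (adj u v) → T (adj v u)
    complete  : ∀ u → u ∈ verts

module Walks (H : FinGraph) (wf : WellFormed H) where
  open FinGraph H
  open WellFormed wf

  _≟ᵥ_ : (u v : V) → Dec (u ≡ v)
  u ≟ᵥ v = map′ eqV-sound (λ { refl → eqV-refl u }) (T? (eqV u v))

  infixr 5 _∷_

  -- Walk k u v is a walk of length at most k: the empty walk has every length bound.
  data Walk : ℕ → V → V → Set where
    []  : ∀ {k u} → Walk k u u
    _∷_ : ∀ {k u w v} → T (adj u w) → Walk k w v → Walk (suc k) u v

  walk-suc : ∀ {k u v} → Walk k u v → Walk (suc k) u v
  walk-suc []       = []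
  walk-suc (a ∷ ws) = a ∷ walk-suc ws

  walk-≤ : ∀ {j k u v} → j ≤ k → Walk j u v → Walk k u v
  walk-≤ _         []       = []
  walk-≤ (s≤s j≤k) (a ∷ ws) = a ∷ walk-≤ j≤k ws

  _++ʷ_ : ∀ {j k u w v} → Walk j u w → Walk k w v → Walk (j + k) u v
  _++ʷ_ {j} [] ws = walk-≤ (m≤n+m _ j) ws
  (a ∷ ws) ++ʷ ws′ = a ∷ (ws ++ʷ ws′)

  _∷ʳ_ : ∀ {k u w v} → Walk k u w → T (adj w v) → Walk (suc k) u v
  []       ∷ʳ a = a ∷ []
  (b ∷ ws) ∷ʳ a = b ∷ (ws ∷ʳ a)

  reverse : ∀ {k u v} → Walk k u v → Walk k v u
  reverse []       = []
  reverse (a ∷ ws) = reverse ws ∷ʳ adj-sym a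

  within-refl : ∀ k u → T (within H k u u)
  within-refl zero    u = eqV-refl u
  within-refl (suc k) u = from T-∨ (inj₁ (within-refl k u))

  walk⇒within : ∀ {k u v} → Walk k u v → T (within H k u v)
  walk⇒within {k} {u} []                = within-refl k u
  walk⇒within (_∷_ {w = w} a ws) =
    from T-∨ (inj₂ (any⁺ _ (lose (complete w) (from T-∧ (a , walk⇒within ws)))))

  within⇒walk : ∀ k {u v} → T (within H k u v) → Walk k u v
  within⇒walk zero    h with eqV-sound h
  ... | refl = []
  within⇒walk (suc k) {u} {v} h with to T-∨ h
  ... | inj₁ h′ = walk-suc (within⇒walk k h′)
  ... | inj₂ h′ with satisfied (any⁻ (λ w → adj u w ∧ within H k w v) verts h′)
  ...   | w , aw = let a , h″ = to T-∧ aw in a ∷ within⇒walk k h″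

  search-≤ : ∀ {u v} fuel s {k} → s ≤ k → Walk k u v → search H fuel s u v ≤ k
  search-≤ zero s s≤k ws = s≤k
  search-≤ {u} {v} (suc fuel) s s≤k ws with within H s u v in found
  ... | true  = s≤k
  ... | false with m≤n⇒m<n∨m≡n s≤k
  ...   | inj₁ s<k  = search-≤ fuel (suc s) s<k ws
  ...   | inj₂ refl = ⊥-elim (subst T found (walk⇒within ws))

  search-found : ∀ {u v} fuel s → search H fuel s u v < s + fuel →
                 Walk (search H fuel s u v) u v
  search-found zero s lt = ⊥-elim (<-irrefl (sym (+-identityʳ s)) lt)
  search-found {u} {v} (suc fuel) s lt with within H s u v in found
  ... | true  = within⇒walk s (subst T (sym found) _)
  ... | false = search-found fuel (suc s) (subst (search H fuel (suc s) u v <_) (+-suc s fuel) lt)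

  dist-minimal : ∀ {k u v} → Walk k u v → dist H u v ≤ k
  dist-minimal = search-≤ (length verts) 0 z≤n

  WeakHom : (V → V) → Set
  WeakHom f = ∀ {u w} → T (adj u w) → f u ≡ f w ⊎ T (adj (f u) (f w))

  module _ {f : V → V} (hom : WeakHom f) where

    hom-step : ∀ {k u w v} → T (adj u w) → Walk k (f w) v → Walk (suc k) (f u) v
    hom-step {v = v} a ws with hom a
    ... | inj₁ fu≡fw = subst (λ x → Walk _ x v) (sym fu≡fw) (walk-suc ws)
    ... | inj₂ a′    = a′ ∷ ws

    walk-map : ∀ {k u v} → Walk k u v → Walk k (f u) (f v)
    walk-map []       = []
    walk-map (a ∷ ws) = hom-step a (walk-map ws)

    -- A walk from the side to its complement uses a collapsed edge, so its image is shorter.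
    walk-contract : (side : V → Bool) →
                    (∀ {u w} → T (adj u w) → T (side u) → ¬ T (side w) → f u ≡ f w) →
                    ∀ {k u v} → T (side u) → ¬ T (side v) → Walk (suc k) u v → Walk k (f u) (f v)
    walk-contract side collapse su sv [] = ⊥-elim (sv su)
    walk-contract side collapse su sv (_∷_ {w = w} a ws) with T? (side w)
    walk-contract side collapse {zero}  su sv (a ∷ [])  | yes sw = ⊥-elim (sv sw)
    walk-contract side collapse {suc k} su sv (a ∷ ws)  | yes sw =
      hom-step a (walk-contract side collapse sw sv ws)
    walk-contract side collapse {k} {v = v} su sv (a ∷ ws) | no sw =
      subst (λ x → Walk k x (f v)) (sym (collapse a su sw)) (walk-map ws)

  -- dist gives up after |V| steps, so it is the graph distance only for pairs joined by a
  -- walk shorter than |V|.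
  module Connected (connected : ∀ u v → Σ ℕ λ k → k < length verts × Walk k u v) where

    walk-dist : ∀ {u v} → Walk (dist H u v) u v
    walk-dist {u} {v} with connected u v
    ... | k , k<|V| , ws = search-found (length verts) 0 (≤-<-trans (dist-minimal ws) k<|V|)

    <-dist : ∀ {k u v} → ¬ Walk k u v → k < dist H u v
    <-dist {k} {u} {v} no-walk with k <? dist H u v
    ... | yes k<d = k<d
    ... | no  k≮d = ⊥-elim (no-walk (walk-≤ (≮⇒≥ k≮d) walk-dist))

    dist-sym : ∀ u v → dist H u v ≡ dist H v u
    dist-sym u v = ≤-antisym (dist-minimal (reverse walk-dist)) (dist-minimal (reverse walk-dist))

    dist-pos : ∀ {u v} → u ≢ v → 0 < dist H u v
    dist-pos u≢v = <-dist λ { [] → u≢v refl }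

    dist-≥2 : ∀ {u v} → u ≢ v → ¬ T (adj u v) → 1 < dist H u v
    dist-≥2 u≢v ¬a = <-dist λ { [] → u≢v refl ; (a ∷ []) → ¬a a }

    module _ {ℓ c : V} (pendant : ∀ {w} → T (adj ℓ w) → w ≡ c) where

      dist-pendant : ∀ {x} → x ≢ ℓ → dist H c x < dist H ℓ x
      dist-pendant {x} x≢ℓ = through-c walk-dist
        where
          through-c : ∀ {k} → Walk k ℓ x → dist H c x < k
          through-c []      = ⊥-elim (x≢ℓ refl)
          through-c (a ∷ ws) with pendant a
          ... | refl = s≤s (dist-minimal ws)

      dist-to-pendant : ∀ {x} → x ≢ ℓ → dist H x c < dist H x ℓ
      dist-to-pendant {x} x≢ℓ =
        subst₂ _<_ (dist-sym c x) (dist-sym ℓ x) (dist-pendant x≢ℓ)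

    dist-map : ∀ {f} → WeakHom f → ∀ {u v} → dist H (f u) (f v) ≤ dist H u v
    dist-map hom = dist-minimal (walk-map hom walk-dist)

    dist-contract : ∀ {f} → WeakHom f → (side : V → Bool) →
                    (∀ {u w} → T (adj u w) → T (side u) → ¬ T (side w) → f u ≡ f w) →
                    ∀ {u v} → T (side u) → ¬ T (side v) → dist H (f u) (f v) < dist H u v
    dist-contract {f} hom side collapse {u} {v} su sv = shorter walk-dist
      where
        shorter : ∀ {k} → Walk k u v → dist H (f u) (f v) < k
        shorter {zero}  []  = ⊥-elim (sv su)
        shorter {suc k} ws  = s≤s (dist-minimal (walk-contract hom side collapse su sv ws))

module Elements (H : FinGraph) where
  open FinGraph H

  data EdgeOf (u v : V) : Elem H → Set where
    forward  : (a : T (adj u v)) → EdgeOf u v (edg u v a)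
    backward : (a : T (adj v u)) → EdgeOf u v (edg v u a)

  EdgeOf-swap : ∀ {u v y} → EdgeOf u v y → EdgeOf v u y
  EdgeOf-swap (forward a)  = backward a
  EdgeOf-swap (backward a) = forward a

  EdgeOf-same : ∀ {u v y₁ y₂} → EdgeOf u v y₁ → EdgeOf u v y₂ → SameElem H y₁ y₂
  EdgeOf-same (forward _)  (forward _)  = inj₁ (refl , refl)
  EdgeOf-same (forward _)  (backward _) = inj₂ (refl , refl)
  EdgeOf-same (backward _) (forward _)  = inj₂ (refl , refl)
  EdgeOf-same (backward _) (backward _) = inj₁ (refl , refl)

  distE-EdgeOf : ∀ {u v y} x → EdgeOf u v y → distE H x y ≡ dist H x u ⊓ dist H x v
  distE-EdgeOf x (forward _)  = refl
  distE-EdgeOf x (backward _) = ⊓-comm _ _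

  module _ {u v x : V} {y : Elem H} (e : EdgeOf u v y) where

    distE-EdgeOf-≥ : ∀ {ℓ} → ℓ ≤ dist H x u → ℓ ≤ dist H x v → ℓ ≤ distE H x y
    distE-EdgeOf-≥ {ℓ} ℓ≤u ℓ≤v = subst (ℓ ≤_) (sym (distE-EdgeOf x e)) (⊓-glb ℓ≤u ℓ≤v)

    distE-EdgeOf-≤ : ∀ {ℓ} → dist H x u ≤ ℓ ⊎ dist H x v ≤ ℓ → distE H x y ≤ ℓ
    distE-EdgeOf-≤ {ℓ} close = subst (_≤ ℓ) (sym (distE-EdgeOf x e)) (min-close close)
      where
        min-close : ∀ {a b ℓ} → a ≤ ℓ ⊎ b ≤ ℓ → a ⊓ b ≤ ℓ
        min-close {a} {b} (inj₁ a≤ℓ) = ≤-trans (m⊓n≤m a b) a≤ℓ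
        min-close {a} {b} (inj₂ b≤ℓ) = ≤-trans (m⊓n≤n a b) b≤ℓ

    distE-EdgeOf-≤⁻ : ∀ {ℓ} → distE H x y ≤ ℓ → dist H x u ≤ ℓ ⊎ dist H x v ≤ ℓ
    distE-EdgeOf-≤⁻ {ℓ} close with ≤-total (dist H x u) (dist H x v)
    ... | inj₁ u≤v = inj₁ (subst (_≤ ℓ) (trans (distE-EdgeOf x e) (m≤n⇒m⊓n≡m u≤v)) close)
    ... | inj₂ v≤u = inj₂ (subst (_≤ ℓ) (trans (distE-EdgeOf x e) (m≥n⇒m⊓n≡n v≤u)) close)

  record Indistinguishable (M : V → Bool) (y₁ y₂ : Elem H) : Set where
    constructor indistinguishable
    field same-distE : ∀ z → T (M z) → distE H z y₁ ≡ distE H z y₂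

  open Indistinguishable public

  Indistinguishable-sym : ∀ {M y₁ y₂} → Indistinguishable M y₁ y₂ → Indistinguishable M y₂ y₁
  Indistinguishable-sym ind = indistinguishable λ z z∈M → sym (same-distE ind z z∈M)

  isMixedMetricGenerator : (∀ u → u ∈ verts) → ∀ {M} →
    (∀ y₁ y₂ → Indistinguishable M y₁ y₂ → SameElem H y₁ y₂) → IsMixedMetricGenerator H M
  isMixedMetricGenerator complete {M} resolves y₁ y₂ y₁≉y₂
    with any? (λ z → T? (M z) ×-dec ¬? (distE H z y₁ ≟ distE H z y₂)) verts
  ... | yes separated = satisfied separated
  ... | no  none      = ⊥-elim (y₁≉y₂ (resolves y₁ y₂ agree))
    where
      agree : Indistinguishable M y₁ y₂
      agree = indistinguishable λ z z∈M → decidable-stable (distE H z y₁ ≟ distE H z y₂)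
                      (λ differ → none (lose (complete z) (z∈M , differ)))

==ᶠ-sound : ∀ {n} {i j : Fin n} → T (i ==ᶠ j) → i ≡ j
==ᶠ-sound = toWitness

==ᶠ-refl : ∀ {n} (i : Fin n) → T (i ==ᶠ i)
==ᶠ-refl i = fromWitness refl

==ᶠ-sym : ∀ {n} {i j : Fin n} → T (i ==ᶠ j) → T (j ==ᶠ i)
==ᶠ-sym i==j = fromWitness (sym (==ᶠ-sound i==j))

toℕ-next : ∀ {n} (i : Fin (suc n)) → toℕ (next i) ≡ suc (toℕ i) % suc n
toℕ-next i = toℕ-fromℕ< _

next-≢ : ∀ {n} (i : Fin (suc (suc n))) → next i ≢ i
next-≢ {n} i next≡i with suc (toℕ i) <? suc (suc n)
... | yes i+1<n = 1+n≢n (trans (sym (m<n⇒m%n≡m i+1<n)) (trans (sym (toℕ-next i)) (cong toℕ next≡i)))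
... | no  i+1≮n = 0≢1+n (trans (sym wraps) (trans (cong toℕ next≡i) (suc-injective i+1≡n)))
  where
    i+1≡n : suc (toℕ i) ≡ suc (suc n)
    i+1≡n = ≤-antisym (toℕ<n i) (≮⇒≥ i+1≮n)
    wraps : toℕ (next i) ≡ 0
    wraps = trans (toℕ-next i) (trans (cong (_% suc (suc n)) i+1≡n) (n%n≡0 (suc (suc n))))

next-fromℕ< : ∀ {n t} (t<n : t < suc n) (t+1<n : suc t < suc n) → next (fromℕ< t<n) ≡ fromℕ< t+1<n
next-fromℕ< {n} {t} t<n t+1<n = toℕ-injective (begin
  toℕ (next (fromℕ< t<n))          ≡⟨ toℕ-next (fromℕ< t<n) ⟩
  suc (toℕ (fromℕ< t<n)) % suc n   ≡⟨ cong (λ k → suc k % suc n) (toℕ-fromℕ< t<n) ⟩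
  suc t % suc n                    ≡⟨ m<n⇒m%n≡m t+1<n ⟩
  suc t                            ≡⟨ toℕ-fromℕ< t+1<n ⟨
  toℕ (fromℕ< t+1<n)               ∎)
  where open ≡-Reasoning

rim-adj-≢ : ∀ {n} {i j : Fin (suc (suc n))} → T ((j ==ᶠ next i) ∨ (i ==ᶠ next j)) → j ≢ i
rim-adj-≢ {i = i} {j} a j≡i with to T-∨ a
... | inj₁ j==i+1 = next-≢ i (sym (trans (sym j≡i) (==ᶠ-sound j==i+1)))
... | inj₂ i==j+1 = next-≢ j (sym (trans j≡i (==ᶠ-sound i==j+1)))

eqKind-sound : ∀ {κ μ} → T (eqKind κ μ) → κ ≡ μ
eqKind-sound {p} {p} _ = refl
eqKind-sound {q} {q} _ = refl
eqKind-sound {r} {r} _ = refl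

eqKind-refl : ∀ κ → T (eqKind κ κ)
eqKind-refl p = _
eqKind-refl q = _
eqKind-refl r = _

webEq-sound : ∀ {n} {x y : WebV n} → T (webEq x y) → x ≡ y
webEq-sound {x = κ , i} {μ , j} x==y =
  let κ==μ , i==j = to T-∧ x==y in cong₂ _,_ (eqKind-sound {κ} {μ} κ==μ) (==ᶠ-sound i==j)

webEq-refl : ∀ {n} (x : WebV n) → T (webEq x x)
webEq-refl (κ , i) = from T-∧ (eqKind-refl κ , ==ᶠ-refl i)

webAdj-sym : ∀ {n} {x y : WebV n} → T (webAdj x y) → T (webAdj y x)
webAdj-sym {x = p , i} {p , j} a = subst T (∨-comm (j ==ᶠ next i) (i ==ᶠ next j)) a
webAdj-sym {x = q , i} {q , j} a = subst T (∨-comm (j ==ᶠ next i) (i ==ᶠ next j)) a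
webAdj-sym {x = p , i} {q , j} a = ==ᶠ-sym a
webAdj-sym {x = q , i} {p , j} a = ==ᶠ-sym a
webAdj-sym {x = q , i} {r , j} a = ==ᶠ-sym a
webAdj-sym {x = r , i} {q , j} a = ==ᶠ-sym a

next-adj : ∀ {n} {i j : Fin (suc n)} → next i ≡ j → T (webAdj (p , i) (p , j))
next-adj {i = i} {j} next≡j = from (T-∨ {j ==ᶠ next i} {i ==ᶠ next j}) (inj₁ (fromWitness (sym next≡j)))

layer : ∀ {n} → Kind → List (WebV n)
layer κ = map (κ ,_) (allFin _)

∈-layer : ∀ {n} κ (i : Fin n) → (κ , i) ∈ layer κ
∈-layer κ i = ∈-map⁺ (κ ,_) (∈-allFin i)

all-layer : ∀ {n} {P : WebV n → Set} κ → (∀ i → P (κ , i)) → All P (layer κ)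
all-layer κ all = All.map⁺ {f = κ ,_} (All.tabulate⁺ {f = λ i → i} all)

length-layer : ∀ {n} κ → length (layer {n} κ) ≡ n
length-layer {n} κ = trans (length-map (κ ,_) (allFin n)) (length-tabulate {n = n} (λ i → i))

webVerts-complete : ∀ {n} (x : WebV n) → x ∈ webVerts n
webVerts-complete (p , i) = ∈-++⁺ˡ (∈-layer p i)
webVerts-complete (q , i) = ∈-++⁺ʳ (layer p) (∈-++⁺ˡ (∈-layer q i))
webVerts-complete (r , i) = ∈-++⁺ʳ (layer p) (∈-++⁺ʳ (layer q) (∈-layer r i))

length-webVerts : ∀ n → length (webVerts n) ≡ n + (n + n)
length-webVerts n = trans (length-++ (layer {n} p) {layer q ++ layer r})
  (cong₂ _+_ (length-layer {n} p) (trans (length-++ (layer {n} q) {layer r})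
    (cong₂ _+_ (length-layer {n} q) (length-layer {n} r))))

web-wellFormed : ∀ {n} → WellFormed (Web n)
web-wellFormed = record
  { eqV-sound = webEq-sound
  ; eqV-refl  = webEq-refl
  ; adj-sym   = λ {x} {y} → webAdj-sym {x = x} {y}
  ; complete  = webVerts-complete
  }

module WebGraph (m : ℕ) where

  N : ℕ
  N = suc (suc (suc m))

  open Walks (Web N) web-wellFormed public

  rim-walk : ∀ t (t<N : t < N) → Walk t (p , fz) (p , fromℕ< t<N)
  rim-walk zero    _     = []
  rim-walk (suc t) t+1<N = rim-walk t t<N ∷ʳ next-adj {i = fromℕ< t<N} (next-fromℕ< t<N t+1<N)
    where t<N = <-trans (n<1+n t) t+1<N

  p₀-walk : ∀ i → Walk (toℕ i) (p , fz) (p , i)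
  p₀-walk i = subst (λ j → Walk (toℕ i) (p , fz) (p , j)) (fromℕ<-toℕ i (toℕ<n i)) (rim-walk (toℕ i) (toℕ<n i))

  to-p : ∀ κ i → Walk 2 (κ , i) (p , i)
  to-p p i = []
  to-p q i = ==ᶠ-refl i ∷ []
  to-p r i = _∷_ {w = q , i} (==ᶠ-refl i) (==ᶠ-refl i ∷ [])

  -- Every vertex reaches the rim in two steps and p₀ reaches p_i in i steps, which gives 2N + 2 < 3N.
  connected : ∀ x y → Σ ℕ λ k → k < length (webVerts N) × Walk k x y
  connected (κ , i) (μ , j) = diameter-bound , diameter-bound<|V| ,
    walk-≤ (+-monoʳ-≤ 2 (+-mono-≤ (toℕ≤pred[n] i) (+-monoˡ-≤ 2 (toℕ≤pred[n] j))))
      (to-p κ i ++ʷ (reverse (p₀-walk i) ++ʷ (p₀-walk j ++ʷ reverse (to-p μ j))))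
    where
      diameter-bound : ℕ
      diameter-bound = 2 + (suc (suc m) + (suc (suc m) + 2))
      open +-*-Solver
      diameter-bound<|V| : diameter-bound < length (webVerts N)
      diameter-bound<|V| = subst (diameter-bound <_)
        (trans (solve 1 (λ m → con 1 :+ (con 2 :+ (con 2 :+ m :+ (con 2 :+ m :+ con 2)) :+ m)
                            := con 3 :+ m :+ (con 3 :+ m :+ (con 3 :+ m))) refl m)
               (sym (length-webVerts N)))
        (s≤s (m≤m+n diameter-bound m))

  open Connected connected public

  d : WebV N → WebV N → ℕ
  d = dist (Web N)

  height : Kind → ℕ
  height r = 0
  height q = 1
  height p = 2

  r-pendant : ∀ (j : Fin N) {w} → T (webAdj (r , j) w) → w ≡ (q , j)
  r-pendant j {q , k} a = cong (q ,_) (sym (==ᶠ-sound a))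

  dist-via-q : ∀ j {x} → x ≢ (r , j) → d (q , j) x < d (r , j) x
  dist-via-q j = dist-pendant {r , j} {q , j} (r-pendant j)

  dist-to-q : ∀ j {x} → x ≢ (r , j) → d x (q , j) < d x (r , j)
  dist-to-q j = dist-to-pendant {r , j} {q , j} (r-pendant j)

  walk-from-r : ∀ κ i → Walk (height κ) (r , i) (κ , i)
  walk-from-r r i = []
  walk-from-r q i = ==ᶠ-refl i ∷ []
  walk-from-r p i = _∷_ {w = q , i} (==ᶠ-refl i) (==ᶠ-refl i ∷ [])

  dist-r-spoke : ∀ κ i → d (r , i) (κ , i) ≤ height κ
  dist-r-spoke κ i = dist-minimal (walk-from-r κ i)

  height-≤-dist-r : ∀ κ i j → height κ ≤ d (r , j) (κ , i)
  height-≤-dist-r r i j = z≤n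
  height-≤-dist-r q i j = dist-pos {r , j} {q , i} λ ()
  height-≤-dist-r p i j =
    ≤-trans (s≤s (dist-pos {q , j} {p , i} λ ())) (dist-via-q j {p , i} λ ())

  dist-r-other-spoke : ∀ κ i j → j ≢ i → height κ < d (r , j) (κ , i)
  dist-r-other-spoke r i j j≢i = dist-pos {r , j} {r , i} λ rj≡ri → j≢i (cong proj₂ rj≡ri)
  dist-r-other-spoke q i j j≢i =
    ≤-trans (s≤s (dist-pos {q , j} {q , i} λ qj≡qi → j≢i (cong proj₂ qj≡qi))) (dist-via-q j {q , i} λ ())
  dist-r-other-spoke p i j j≢i =
    ≤-trans (s≤s (dist-≥2 {q , j} {p , i} (λ ()) (j≢i ∘ ==ᶠ-sound))) (dist-via-q j {p , i} λ ())

  index-of-close : ∀ {ℓ} κ i j → ℓ ≤ height κ → d (r , j) (κ , i) ≤ ℓ → j ≡ i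
  index-of-close κ i j ℓ≤h close =
    decidable-stable (j F.≟ i) λ j≢i → <⇒≱ (dist-r-other-spoke κ i j j≢i) (≤-trans close ℓ≤h)

  project-p : WebV N → WebV N
  project-p (_ , i) = p , i

  project-p-hom : WeakHom project-p
  project-p-hom {p , i} {p , j} a = inj₂ a
  project-p-hom {p , i} {q , j} a = inj₁ (cong (p ,_) (==ᶠ-sound a))
  project-p-hom {q , i} {p , j} a = inj₁ (cong (p ,_) (==ᶠ-sound a))
  project-p-hom {q , i} {q , j} a = inj₂ a
  project-p-hom {q , i} {r , j} a = inj₁ (cong (p ,_) (==ᶠ-sound a))
  project-p-hom {r , i} {q , j} a = inj₁ (cong (p ,_) (==ᶠ-sound a))

  is-p : WebV N → Bool
  is-p (p , _) = true
  is-p (q , _) = false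
  is-p (r , _) = false

  project-p-collapses : ∀ {u w} → T (webAdj u w) → T (is-p u) → ¬ T (is-p w) → project-p u ≡ project-p w
  project-p-collapses {p , i} {p , j} _ _ ¬pw = ⊥-elim (¬pw _)
  project-p-collapses {p , i} {q , j} a _ _   = cong (p ,_) (==ᶠ-sound a)

  dist-p₀ : ∀ i → d (p , fz) (p , i) < d (p , fz) (q , i)
  dist-p₀ i = dist-contract (λ {u} {w} → project-p-hom {u} {w}) is-p
                            (λ {u} {w} → project-p-collapses {u} {w}) {p , fz} {q , i} _ λ ()

  p-to-q : WebV N → WebV N
  p-to-q (p , i) = q , i
  p-to-q (q , i) = q , i
  p-to-q (r , i) = r , i

  p-to-q-hom : WeakHom p-to-q
  p-to-q-hom {p , i} {p , j} a = inj₂ a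
  p-to-q-hom {p , i} {q , j} a = inj₁ (cong (q ,_) (==ᶠ-sound a))
  p-to-q-hom {q , i} {p , j} a = inj₁ (cong (q ,_) (==ᶠ-sound a))
  p-to-q-hom {q , i} {q , j} a = inj₂ a
  p-to-q-hom {q , i} {r , j} a = inj₂ a
  p-to-q-hom {r , i} {q , j} a = inj₂ a

  dist-r-q≤p : ∀ j i → d (r , j) (q , i) ≤ d (r , j) (p , i)
  dist-r-q≤p j i = dist-map {p-to-q} p-to-q-hom {r , j} {p , i}

  open Elements (Web N)

  data Shape : ℕ → Elem (Web N) → Set where
    r-vertex : ∀ i → Shape 0 (vtx (r , i))
    q-vertex : ∀ i → Shape 1 (vtx (q , i))
    p-vertex : ∀ i → Shape 2 (vtx (p , i))
    qr-edge  : ∀ i {y} → EdgeOf (q , i) (r , i) y → Shape 0 y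
    pq-edge  : ∀ i {y} → EdgeOf (p , i) (q , i) y → Shape 1 y
    qq-edge  : ∀ i w {y} → w ≢ i → EdgeOf (q , i) (q , w) y → Shape 1 y
    pp-edge  : ∀ i w {y} → w ≢ i → EdgeOf (p , i) (p , w) y → Shape 2 y

  shape : ∀ y → Σ ℕ λ ℓ → Shape ℓ y
  shape (vtx (r , i)) = 0 , r-vertex i
  shape (vtx (q , i)) = 1 , q-vertex i
  shape (vtx (p , i)) = 2 , p-vertex i
  shape (edg (p , i) (p , j) a) = 2 , pp-edge i j (rim-adj-≢ a) (forward a)
  shape (edg (q , i) (q , j) a) = 1 , qq-edge i j (rim-adj-≢ a) (forward a)
  shape (edg (p , i) (q , j) a) with ==ᶠ-sound a
  ... | refl = 1 , pq-edge i (forward a)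
  shape (edg (q , i) (p , j) a) with ==ᶠ-sound a
  ... | refl = 1 , pq-edge i (backward a)
  shape (edg (q , i) (r , j) a) with ==ᶠ-sound a
  ... | refl = 0 , qr-edge i (forward a)
  shape (edg (r , i) (q , j) a) with ==ᶠ-sound a
  ... | refl = 0 , qr-edge i (backward a)

  Near : ∀ {ℓ y} → Shape ℓ y → Fin N → Set
  Near (r-vertex i)       j = j ≡ i
  Near (q-vertex i)       j = j ≡ i
  Near (p-vertex i)       j = j ≡ i
  Near (qr-edge i _)      j = j ≡ i
  Near (pq-edge i _)      j = j ≡ i
  Near (qq-edge i w _ _)  j = j ≡ i ⊎ j ≡ w
  Near (pp-edge i w _ _)  j = j ≡ i ⊎ j ≡ w

  anchor : ∀ {ℓ y} (s : Shape ℓ y) → Σ (Fin N) (Near s)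
  anchor (r-vertex i)      = i , refl
  anchor (q-vertex i)      = i , refl
  anchor (p-vertex i)      = i , refl
  anchor (qr-edge i _)     = i , refl
  anchor (pq-edge i _)     = i , refl
  anchor (qq-edge i _ _ _) = i , inj₁ refl
  anchor (pp-edge i _ _ _) = i , inj₁ refl

  dist-r : Fin N → Elem (Web N) → ℕ
  dist-r j = distE (Web N) (r , j)

  shape-≤ : ∀ {ℓ y} → Shape ℓ y → ∀ j → ℓ ≤ dist-r j y
  shape-≤ (r-vertex i) j         = z≤n
  shape-≤ (q-vertex i) j         = height-≤-dist-r q i j
  shape-≤ (p-vertex i) j         = height-≤-dist-r p i j
  shape-≤ (qr-edge i e) j        = z≤n
  shape-≤ (pq-edge i e) j        =
    distE-EdgeOf-≥ e (≤-trans (s≤s z≤n) (height-≤-dist-r p i j)) (height-≤-dist-r q i j)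
  shape-≤ (qq-edge i w _ e) j    = distE-EdgeOf-≥ e (height-≤-dist-r q i j) (height-≤-dist-r q w j)
  shape-≤ (pp-edge i w _ e) j    = distE-EdgeOf-≥ e (height-≤-dist-r p i j) (height-≤-dist-r p w j)

  near⇒≤ : ∀ {ℓ y j} (s : Shape ℓ y) → Near s j → dist-r j y ≤ ℓ
  near⇒≤ (r-vertex i) refl               = dist-r-spoke r i
  near⇒≤ (q-vertex i) refl               = dist-r-spoke q i
  near⇒≤ (p-vertex i) refl               = dist-r-spoke p i
  near⇒≤ (qr-edge i e) refl              = distE-EdgeOf-≤ e (inj₂ (dist-r-spoke r i))
  near⇒≤ (pq-edge i e) refl              = distE-EdgeOf-≤ e (inj₂ (dist-r-spoke q i))
  near⇒≤ (qq-edge i w _ e) (inj₁ refl)   = distE-EdgeOf-≤ e (inj₁ (dist-r-spoke q i))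
  near⇒≤ (qq-edge i w _ e) (inj₂ refl)   = distE-EdgeOf-≤ e (inj₂ (dist-r-spoke q w))
  near⇒≤ (pp-edge i w _ e) (inj₁ refl)   = distE-EdgeOf-≤ e (inj₁ (dist-r-spoke p i))
  near⇒≤ (pp-edge i w _ e) (inj₂ refl)   = distE-EdgeOf-≤ e (inj₂ (dist-r-spoke p w))

  ≤⇒near : ∀ {ℓ y j} (s : Shape ℓ y) → dist-r j y ≤ ℓ → Near s j
  ≤⇒near {j = j} (r-vertex i) close        = index-of-close r i j ≤-refl close
  ≤⇒near {j = j} (q-vertex i) close        = index-of-close q i j ≤-refl close
  ≤⇒near {j = j} (p-vertex i) close        = index-of-close p i j ≤-refl close
  ≤⇒near {j = j} (qr-edge i e) close       =
    [ index-of-close q i j z≤n , index-of-close r i j ≤-refl ]′ (distE-EdgeOf-≤⁻ e close)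
  ≤⇒near {j = j} (pq-edge i e) close       =
    [ index-of-close p i j (s≤s z≤n) , index-of-close q i j ≤-refl ]′ (distE-EdgeOf-≤⁻ e close)
  ≤⇒near {j = j} (qq-edge i w _ e) close   =
    Sum.map (index-of-close q i j ≤-refl) (index-of-close q w j ≤-refl) (distE-EdgeOf-≤⁻ e close)
  ≤⇒near {j = j} (pp-edge i w _ e) close   =
    Sum.map (index-of-close p i j ≤-refl) (index-of-close p w j ≤-refl) (distE-EdgeOf-≤⁻ e close)

  basis : WebV N → Bool
  basis (p , i) = i ==ᶠ fz
  basis (q , _) = false
  basis (r , _) = true

  Indist : Elem (Web N) → Elem (Web N) → Set
  Indist = Indistinguishable basis

  same-dist-r : ∀ {y₁ y₂} → Indist y₁ y₂ → ∀ j → dist-r j y₁ ≡ dist-r j y₂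
  same-dist-r ind j = same-distE ind (r , j) _

  level-≤ : ∀ {ℓ₁ ℓ₂ y₁ y₂} → Indist y₁ y₂ → Shape ℓ₁ y₁ → Shape ℓ₂ y₂ → ℓ₂ ≤ ℓ₁
  level-≤ {ℓ₁} {ℓ₂} {y₁} {y₂} ind s₁ s₂ with anchor s₁
  ... | j , near = begin
    ℓ₂           ≤⟨ shape-≤ s₂ j ⟩
    dist-r j y₂  ≡⟨ same-dist-r ind j ⟨
    dist-r j y₁  ≤⟨ near⇒≤ s₁ near ⟩
    ℓ₁           ∎
    where open ≤-Reasoning

  level-unique : ∀ {ℓ₁ ℓ₂ y₁ y₂} → Indist y₁ y₂ → Shape ℓ₁ y₁ → Shape ℓ₂ y₂ → ℓ₁ ≡ ℓ₂
  level-unique ind s₁ s₂ = ≤-antisym (level-≤ (Indistinguishable-sym ind) s₂ s₁) (level-≤ ind s₁ s₂)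

  near-transfer : ∀ {ℓ y₁ y₂} → Indist y₁ y₂ → (s₁ : Shape ℓ y₁) (s₂ : Shape ℓ y₂) →
                  ∀ {j} → Near s₁ j → Near s₂ j
  near-transfer {ℓ} ind s₁ s₂ {j} near = ≤⇒near s₂ (subst (_≤ ℓ) (same-dist-r ind j) (near⇒≤ s₁ near))

  r-vertex≁qr-edge : ∀ {i y} → EdgeOf (q , i) (r , i) y → ¬ Indist (vtx (r , i)) y
  r-vertex≁qr-edge {i} e ind =
    <-irrefl (sym (same-dist-r ind (next i)))
      (≤-<-trans (distE-EdgeOf-≤ e (inj₁ ≤-refl)) (dist-to-q i {r , next i} λ ri+1≡ri → next-≢ i (cong proj₂ ri+1≡ri)))

  q-vertex≁pq-edge : ∀ {i y} → EdgeOf (p , i) (q , i) y → ¬ Indist (vtx (q , i)) y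
  q-vertex≁pq-edge {i} e ind =
    <-irrefl (sym (same-distE ind (p , fz) _)) (≤-<-trans (distE-EdgeOf-≤ e (inj₁ ≤-refl)) (dist-p₀ i))

  rim-edges-same : ∀ κ {i w k w′ y₁ y₂} → w ≢ i →
                   EdgeOf (κ , i) (κ , w) y₁ → EdgeOf (κ , k) (κ , w′) y₂ →
                   (∀ {j} → j ≡ i ⊎ j ≡ w → j ≡ k ⊎ j ≡ w′) → SameElem (Web N) y₁ y₂
  rim-edges-same κ w≢i e e′ ⊆ with pair⊆pair w≢i ⊆
  ... | inj₁ (refl , refl) = EdgeOf-same e e′
  ... | inj₂ (refl , refl) = EdgeOf-same e (EdgeOf-swap e′)

  shapes-same : ∀ {ℓ y₁ y₂} → Indist y₁ y₂ → (s₁ : Shape ℓ y₁) (s₂ : Shape ℓ y₂) →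
                (∀ {j} → Near s₁ j → Near s₂ j) → (∀ {j} → Near s₂ j → Near s₁ j) →
                SameElem (Web N) y₁ y₂
  shapes-same _ (r-vertex i) (r-vertex k) ⊆ _ = cong (r ,_) (⊆ refl)
  shapes-same ind (r-vertex i) (qr-edge k e) ⊆ _ with ⊆ refl
  ... | refl = ⊥-elim (r-vertex≁qr-edge e ind)
  shapes-same ind (qr-edge i e) (r-vertex k) ⊆ _ with ⊆ refl
  ... | refl = ⊥-elim (r-vertex≁qr-edge e (Indistinguishable-sym ind))
  shapes-same _ (qr-edge i e) (qr-edge k e′) ⊆ _ with ⊆ refl
  ... | refl = EdgeOf-same e e′
  shapes-same _ (q-vertex i) (q-vertex k) ⊆ _ = cong (q ,_) (⊆ refl)
  shapes-same ind (q-vertex i) (pq-edge k e) ⊆ _ with ⊆ refl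
  ... | refl = ⊥-elim (q-vertex≁pq-edge e ind)
  shapes-same _ (q-vertex i) (qq-edge k w w≢k _) _ ⊇ = ⊥-elim (¬pair⊆single w≢k ⊇)
  shapes-same ind (pq-edge i e) (q-vertex k) ⊆ _ with ⊆ refl
  ... | refl = ⊥-elim (q-vertex≁pq-edge e (Indistinguishable-sym ind))
  shapes-same _ (pq-edge i e) (pq-edge k e′) ⊆ _ with ⊆ refl
  ... | refl = EdgeOf-same e e′
  shapes-same _ (pq-edge i _) (qq-edge k w w≢k _) _ ⊇ = ⊥-elim (¬pair⊆single w≢k ⊇)
  shapes-same _ (qq-edge i w w≢i _) (q-vertex k) ⊆ _ = ⊥-elim (¬pair⊆single w≢i ⊆)
  shapes-same _ (qq-edge i w w≢i _) (pq-edge k _) ⊆ _ = ⊥-elim (¬pair⊆single w≢i ⊆)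
  shapes-same _ (qq-edge i w w≢i e) (qq-edge k w′ _ e′) ⊆ _ = rim-edges-same q w≢i e e′ ⊆
  shapes-same _ (p-vertex i) (p-vertex k) ⊆ _ = cong (p ,_) (⊆ refl)
  shapes-same _ (p-vertex i) (pp-edge k w w≢k _) _ ⊇ = ⊥-elim (¬pair⊆single w≢k ⊇)
  shapes-same _ (pp-edge i w w≢i _) (p-vertex k) ⊆ _ = ⊥-elim (¬pair⊆single w≢i ⊆)
  shapes-same _ (pp-edge i w w≢i e) (pp-edge k w′ _ e′) ⊆ _ = rim-edges-same p w≢i e e′ ⊆

  indistinguishable⇒same : ∀ y₁ y₂ → Indist y₁ y₂ → SameElem (Web N) y₁ y₂
  indistinguishable⇒same y₁ y₂ ind with shape y₁ | shape y₂
  ... | _ , s₁ | _ , s₂ with level-unique ind s₁ s₂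
  ... | refl = shapes-same ind s₁ s₂ (near-transfer ind s₁ s₂) (near-transfer (Indistinguishable-sym ind) s₂ s₁)

  basis-generator : IsMixedMetricGenerator (Web N) basis
  basis-generator = isMixedMetricGenerator webVerts-complete indistinguishable⇒same

  r-in-generator : ∀ {M} → IsMixedMetricGenerator (Web N) M → ∀ j → T (M (r , j))
  r-in-generator {M} gen j with gen (vtx (q , j)) (edg (q , j) (r , j) (==ᶠ-refl j)) (λ ())
  ... | z , z∈M , separates = subst (T ∘ M) z≡rj z∈M
    where
      z≡rj : z ≡ (r , j)
      z≡rj = decidable-stable (z ≟ᵥ (r , j)) λ z≢rj →
        separates (sym (m≤n⇒m⊓n≡m (<⇒≤ (dist-to-q j z≢rj))))

  rim-in-generator : ∀ {M} → IsMixedMetricGenerator (Web N) M →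
                     Σ (Fin N) λ i → T (M (p , i)) ⊎ T (M (q , i))
  rim-in-generator gen with gen (vtx (q , fz)) (edg (p , fz) (q , fz) _) (λ ())
  ... | (p , i) , z∈M , _         = i , inj₁ z∈M
  ... | (q , i) , z∈M , _         = i , inj₂ z∈M
  ... | (r , j) , _   , separates = ⊥-elim (separates (sym (m≥n⇒m⊓n≡n (dist-r-q≤p j fz))))

  card-layers : ∀ M → card (Web N) M ≡ count M (layer p) + (count M (layer q) + count M (layer r))
  card-layers M = trans (count-++ M (layer p) (layer q ++ layer r))
                        (cong (count M (layer p) +_) (count-++ M (layer q) (layer r)))

  count-layer : ∀ M κ → (∀ i → T (M (κ , i))) → count M (layer κ) ≡ N
  count-layer M κ all = trans (count-all M (all-layer {N} κ all)) (length-layer {N} κ)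

  generator-size : ∀ {M} → IsMixedMetricGenerator (Web N) M → N + 1 ≤ card (Web N) M
  generator-size {M} gen with rim-in-generator gen
  ... | i , M-rim = begin
    N + 1                      ≡⟨ +-comm N 1 ⟩
    1 + N                      ≤⟨ +-mono-≤ rim-counted (≤-reflexive (sym all-r-counted)) ⟩
    (cP + cQ) + cR             ≡⟨ +-assoc cP cQ cR ⟩
    cP + (cQ + cR)             ≡⟨ card-layers M ⟨
    card (Web N) M             ∎
    where
      open ≤-Reasoning
      cP = count M (layer p)
      cQ = count M (layer q)
      cR = count M (layer r)
      all-r-counted : cR ≡ N
      all-r-counted = count-layer M r (r-in-generator {M} gen)
      rim-counted : 1 ≤ cP + cQ
      rim-counted = [ (λ Mp → ≤-trans (count-∈ M (∈-layer p i) Mp) (m≤m+n cP cQ))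
                    , (λ Mq → ≤-trans (count-∈ M (∈-layer q i) Mq) (m≤n+m cQ cP)) ]′ M-rim

  basis-size : card (Web N) basis ≡ N + 1
  basis-size = begin
    card (Web N) basis                                                          ≡⟨ card-layers basis ⟩
    count basis (layer p) + (count basis (layer q) + count basis (layer r))    ≡⟨ cong₂ _+_ count-p (cong₂ _+_ count-q count-r) ⟩
    1 + (0 + N)                                                                 ≡⟨ +-comm 1 N ⟩
    N + 1                                                                       ∎
    where
      open ≡-Reasoning
      count-p : count basis (layer p) ≡ 1
      count-p = cong suc (count-none basis (All.map⁺ {f = p ,_} (All.tabulate⁺ {f = fs} λ _ ())))
      count-q : count basis (layer q) ≡ 0
      count-q = count-none basis (all-layer q λ _ ())
      count-r : count basis (layer r) ≡ N
      count-r = count-layer basis r λ _ → _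

theorem7 : (n : ℕ) → 4 ≤ n → MixedMetricDimensionIs (Web n) (n + 1)
theorem7 (suc (suc (suc (suc k)))) (s≤s (s≤s (s≤s (s≤s z≤n)))) =
  (basis , basis-generator , basis-size) , λ M gen → generator-size gen
  where open WebGraph (suc k)
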